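{- Let $\Gamma_1$ and $\Gamma_2$ be two connected orientations without sources and sinks, of alter-perimeters $s$ and $t$, respectively. Then $\mathrm{SBP}(\Gamma_1,\Gamma_2)$ has exactly $\gcd(s,t)$ connected components.
   Context: A digraph is a pair $({\mathcal V},{\mathcal D})$ with ${\mathcal V}$ a finite non-empty set and ${\mathcal D}$ a set of ordered pairs of distinct vertices (darts). It is an orientation if $(u,v)\in{\mathcal D}$ implies $(v,u)\notin{\mathcal D}$. A source (sink) is a vertex with in-valence (out-valence) $0$. A digraph is connected if its underlying graph $({\mathcal V},{\mathcal D}\cup{\mathcal D}^{ -1})$ is connected; connected components are those of the underlying graph. A walk in an orientation is a sequence $v_0\ldots v_k$ of vertices such that for each $i$ exactly one of $(v_{i-1},v_i)$, $(v_i,v_{i-1})$ is a dart; the step is positive in the first case and negative in the second. The sum of a walk is the number of positive steps minus the number of negative steps. Two vertices are alter-related if there is a walk of sum $0$ between them; this is an equivalence relation, and the number of its classes is the alter-perimeter. For digraphs $\Gamma_1=({\mathcal V}_1,{\mathcal D}_1)$, $\Gamma_2=({\mathcal V}_2,{\mathcal D}_2)$, $\mathrm{SBP}(\Gamma_1,\Gamma_2)$ is the digraph with vertex set ${\mathcal V}_1\times{\mathcal V}_2\times\mathbb Z_2$ whose darts are all $((a,x,0),(b,x,1))$ with $(a,b)\in{\mathcal D}_1$, $x\in{\mathcal V}_2$, and all $((a,x,1),(a,y,0))$ with $a\in{\mathcal V}_1$, $(x,y)\in{\mathcal D}_2$. -}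

module Defs where

import Data.Nat as ℕ
open import Data.Nat using (ℕ)
open import Data.Integer using (ℤ; 0ℤ; 1ℤ; -1ℤ; _+_)
open import Data.Fin using (Fin; zero; suc)
open import Data.Empty using (⊥)
open import Data.Bool using (Bool; true; false)
open import Data.Product using (_×_; _,_; ∃)
open import Data.Sum using (_⊎_)
open import Relation.Binary.PropositionalEquality using (_≡_)
open import Function.Bundles using (_⇔_)
open import Function.Definitions using (Surjective)

record Digraph : Set where
  field
    size : ℕ
    dart : Fin (ℕ.suc size) → Fin (ℕ.suc size) → Bool
    irreflexive : ∀ v → dart v v ≡ false

open Digraph public

Vtx : Digraph → Set
Vtx Γ = Fin (ℕ.suc (size Γ))

Dart : (Γ : Digraph) → Vtx Γ → Vtx Γ → Set
Dart Γ u v = dart Γ u v ≡ true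

module _ {V : Set} (D : V → V → Set) where

  IsOrientation : Set
  IsOrientation = ∀ u v → D u v → D v u → ⊥

  NoSources : Set
  NoSources = ∀ v → ∃ λ u → D u v

  NoSinks : Set
  NoSinks = ∀ v → ∃ λ u → D v u

  data Walk : V → V → Set where
    [] : ∀ {u} → Walk u u
    step : ∀ {u w v} → (D u w ⊎ D w u) → Walk w v → Walk u v

  Connected : V → V → Set
  Connected u v = Walk u v

  IsConnected : Set
  IsConnected = ∀ u v → Connected u v

  data SumWalk : V → V → ℤ → Set where
    [] : ∀ {u} → SumWalk u u 0ℤ
    pos : ∀ {u w v z} → D u w → SumWalk w v z → SumWalk u v (1ℤ + z)
    neg : ∀ {u w v z} → D w u → SumWalk w v z → SumWalk u v (-1ℤ + z)

  AlterRelated : V → V → Set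
  AlterRelated u v = SumWalk u v 0ℤ

HasExactlyClasses : {V : Set} → (V → V → Set) → ℕ → Set
HasExactlyClasses {V} R k =
  ∃ λ (c : V → Fin k) → Surjective _≡_ _≡_ c × (∀ u v → (c u ≡ c v) ⇔ R u v)

AlterPerimeter : Digraph → ℕ → Set
AlterPerimeter Γ s = HasExactlyClasses (AlterRelated (Dart Γ)) s

NumComponents : {V : Set} → (V → V → Set) → ℕ → Set
NumComponents D k = HasExactlyClasses (Connected D) k

data SBPDart (Γ₁ Γ₂ : Digraph) :
     Vtx Γ₁ × Vtx Γ₂ × Fin 2 → Vtx Γ₁ × Vtx Γ₂ × Fin 2 → Set where
  first  : ∀ {a b x} → Dart Γ₁ a b →
           SBPDart Γ₁ Γ₂ (a , x , zero) (b , x , suc zero)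
  second : ∀ {a x y} → Dart Γ₂ x y →
           SBPDart Γ₁ Γ₂ (a , x , suc zero) (a , y , zero)

-- Sending the alter-class of the tail of a dart to that of its head is a well-defined
-- injection σ of the s alter-classes of Γ₁; connectivity makes σ a single s-cycle, so Γ₁
-- carries a level ℓ₁ : V₁ → ℤ/s that rises by 1 along darts and whose fibres are the
-- alter-classes (likewise ℓ₂ : V₂ → ℤ/t). Every dart of SBP(Γ₁,Γ₂) preserves the potential
-- ℓ₁ a − ℓ₂ x + [layer 0] modulo gcd(s,t), and the potential takes every residue.
-- Conversely, while one coordinate follows an alter-walk the other can oscillate, since its
-- factor has no sources or sinks, and k simultaneous forward steps raise both levels by k;
-- by the Chinese remainder theorem this joins any two vertices of equal potential.

module Submission where

open import Defs
open import Data.Nat as ℕ using (ℕ; zero; suc; pred; _%_; _/_; _<_; _≤_; NonZero)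
import Data.Nat.Properties as ℕ
open import Data.Nat.DivMod using (m≡m%n+[m/n]*n; m%n<n; m<n⇒m%n≡m; [m+kn]%n≡m%n)
open import Data.Nat.Divisibility using (_∣_; divides; m∣m*n; n∣m*n)
open import Data.Nat.GCD using (gcd; gcd-GCD; gcd[m,n]∣m; gcd[m,n]∣n; gcd[m,n]≢0; module Bézout)
open import Data.Nat.GeneralisedArithmetic using (fold; fold-+; iterate)
open import Data.Integer using (ℤ; +_; -[1+_]; 0ℤ; 1ℤ; -1ℤ; _+_; _-_; _*_; -_; _%ℕ_; _/ℕ_)
import Data.Integer.Properties as ℤ
open import Data.Integer.DivMod using (a≡a%ℕn+[a/ℕn]*n; n%ℕd<d)
open import Data.Integer.Tactic.RingSolver using (solve-∀)
open import Data.Fin using (Fin; zero; suc; toℕ; fromℕ<)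
import Data.Fin.Properties as Fin
open import Data.Product using (∃; ∃₂; _×_; _,_; proj₁; proj₂)
open import Data.Product.Relation.Binary.Pointwise.NonDependent using (Pointwise)
open import Data.Sum using (inj₁; inj₂)
open import Data.Empty using (⊥-elim)
open import Function.Base using (_∘_; _∘′_; flip)
open import Function.Bundles using (_⇔_; mk⇔; Equivalence)
open import Function.Definitions using (Injective)
import Function.Properties.Equivalence as ⇔
open import Relation.Binary.Bundles using (Setoid)
open import Relation.Binary.Definitions using (tri<; tri≈; tri>)
open import Relation.Binary.PropositionalEquality
import Relation.Binary.Reasoning.Setoid

infix 4 _≡_mod_
record _≡_mod_ (i j : ℤ) (n : ℕ) : Set where
  constructor _,_
  field
    quotient : ℤ
    equation : i ≡ j + quotient * + n

module _ {n : ℕ} where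

  mod-reflexive : ∀ {i j} → i ≡ j → i ≡ j mod n
  mod-reflexive {i} refl = 0ℤ , identity i (+ n)
    where
    identity : ∀ i m → i ≡ i + 0ℤ * m
    identity = solve-∀

  mod-sym : ∀ {i j} → i ≡ j mod n → j ≡ i mod n
  mod-sym {j = j} (k , e) = - k , trans (identity j k (+ n)) (cong (_+ - k * + n) (sym e))
    where
    identity : ∀ j k m → j ≡ j + k * m + - k * m
    identity = solve-∀

  mod-trans : ∀ {i j l} → i ≡ j mod n → j ≡ l mod n → i ≡ l mod n
  mod-trans {l = l} (k , refl) (k′ , refl) = k′ + k , identity l k′ k (+ n)
    where
    identity : ∀ l k′ k m → l + k′ * m + k * m ≡ l + (k′ + k) * m
    identity = solve-∀

  mod-+-cong : ∀ {i j i′ j′} → i ≡ j mod n → i′ ≡ j′ mod n → i + i′ ≡ j + j′ mod n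
  mod-+-cong {j = j} {j′ = j′} (k , refl) (k′ , refl) = k + k′ , identity j j′ k k′ (+ n)
    where
    identity : ∀ j j′ k k′ m → j + k * m + (j′ + k′ * m) ≡ j + j′ + (k + k′) * m
    identity = solve-∀

  mod-neg : ∀ {i j} → i ≡ j mod n → - i ≡ - j mod n
  mod-neg {j = j} (k , refl) = - k , identity j k (+ n)
    where
    identity : ∀ j k m → - (j + k * m) ≡ - j + - k * m
    identity = solve-∀

  mod-refl : ∀ {i} → i ≡ i mod n
  mod-refl = mod-reflexive refl

  mod-+-congˡ : ∀ i {j j′} → j ≡ j′ mod n → i + j ≡ i + j′ mod n
  mod-+-congˡ i = mod-+-cong (mod-refl {i})

  mod-+-congʳ : ∀ {i i′} j → i ≡ i′ mod n → i + j ≡ i′ + j mod n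
  mod-+-congʳ j i≡i′ = mod-+-cong i≡i′ (mod-refl {j})

  mod-setoid : Setoid _ _
  mod-setoid = record
    { Carrier = ℤ
    ; _≈_ = λ i j → i ≡ j mod n
    ; isEquivalence = record { refl = mod-refl ; sym = mod-sym ; trans = λ {i} {j} {l} → mod-trans {i} {j} {l} }
    }

mod-∣ : ∀ {d n i j} → d ∣ n → i ≡ j mod n → i ≡ j mod d
mod-∣ {d} {j = j} (divides q refl) (k , refl) = k * + q , (begin
  j + k * + (q ℕ.* d)  ≡⟨ cong (λ m → j + k * m) (ℤ.pos-* q d) ⟩
  j + k * (+ q * + d)  ≡⟨ cong (_+_ j) (ℤ.*-assoc k (+ q) (+ d)) ⟨
  j + k * + q * + d    ∎)
  where open ≡-Reasoning

module _ {n : ℕ} .{{_ : NonZero n}} where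

  mod-%ℕ : ∀ i → i ≡ + (i %ℕ n) mod n
  mod-%ℕ i = i /ℕ n , a≡a%ℕn+[a/ℕn]*n i n

  private
    mod-unique⁺ : ∀ {a b} m → a < n → b < n → + a ≡ + b + + m * + n → a ≡ b
    mod-unique⁺ {a} {b} m a<n b<n e = begin
      a                     ≡⟨ m<n⇒m%n≡m a<n ⟨
      a ℕ.% n               ≡⟨ cong (ℕ._% n) a≡b+mn ⟩
      (b ℕ.+ m ℕ.* n) ℕ.% n ≡⟨ [m+kn]%n≡m%n b m n ⟩
      b ℕ.% n               ≡⟨ m<n⇒m%n≡m b<n ⟩
      b                     ∎
      where
      open ≡-Reasoning
      a≡b+mn : a ≡ b ℕ.+ m ℕ.* n
      a≡b+mn = ℤ.+-injective (trans e (trans (cong (_+_ (+ b)) (sym (ℤ.pos-* m n)))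
                                             (sym (ℤ.pos-+ b (m ℕ.* n)))))

  mod-unique : ∀ {a b} → a < n → b < n → + a ≡ + b mod n → a ≡ b
  mod-unique a<n b<n (+ m , e) = mod-unique⁺ m a<n b<n e
  mod-unique a<n b<n a≡b@(-[1+ m ] , _) = sym (mod-unique⁺ (suc m) b<n a<n (_≡_mod_.equation (mod-sym a≡b)))

  %ℕ-≡⇔mod : ∀ {i j} → (i %ℕ n ≡ j %ℕ n) ⇔ (i ≡ j mod n)
  %ℕ-≡⇔mod {i} {j} = mk⇔
    (λ e → mod-trans (mod-%ℕ i) (mod-trans (mod-reflexive (cong +_ e)) (mod-sym (mod-%ℕ j))))
    (λ i≡j → mod-unique (n%ℕd<d i n) (n%ℕd<d j n)
               (mod-trans (mod-sym (mod-%ℕ i)) (mod-trans i≡j (mod-%ℕ j))))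

  residue : ℤ → Fin n
  residue i = fromℕ< (n%ℕd<d i n)

  toℕ-residue : ∀ i → toℕ (residue i) ≡ i %ℕ n
  toℕ-residue i = Fin.toℕ-fromℕ< (n%ℕd<d i n)

  residue-≡⇔mod : ∀ {i j} → (residue i ≡ residue j) ⇔ (i ≡ j mod n)
  residue-≡⇔mod {i} {j} = mk⇔
    (λ e → Equivalence.to %ℕ-≡⇔mod (trans (sym (toℕ-residue i)) (trans (cong toℕ e) (toℕ-residue j))))
    (λ i≡j → Fin.toℕ-injective
      (trans (toℕ-residue i) (trans (Equivalence.from %ℕ-≡⇔mod i≡j) (sym (toℕ-residue j)))))

  residue-toℕ : ∀ (r : Fin n) → residue (+ toℕ r) ≡ r
  residue-toℕ r = Fin.toℕ-injective (trans (toℕ-residue (+ toℕ r)) (m<n⇒m%n≡m (Fin.toℕ<n r)))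

private
  pos-+-* : ∀ a b c d e → a ℕ.+ b ℕ.* c ≡ d ℕ.* e → + a + + b * + c ≡ + d * + e
  pos-+-* a b c d e eq = begin
    + a + + b * + c      ≡⟨ cong (_+_ (+ a)) (ℤ.pos-* b c) ⟨
    + a + + (b ℕ.* c)    ≡⟨ ℤ.pos-+ a (b ℕ.* c) ⟨
    + (a ℕ.+ b ℕ.* c)    ≡⟨ cong +_ eq ⟩
    + (d ℕ.* e)          ≡⟨ ℤ.pos-* d e ⟩
    + d * + e            ∎
    where open ≡-Reasoning

bézout : ∀ m n → ∃₂ λ x y → + gcd m n ≡ x * + m + y * + n
bézout m n with Bézout.identity (gcd-GCD m n)
... | Bézout.+- x y eq = + x , - + y ,
  trans (identity (+ gcd m n) (+ y) (+ n)) (cong (_+ - + y * + n) (pos-+-* (gcd m n) y n x m eq))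
  where
  identity : ∀ d y n → d ≡ d + y * n + - y * n
  identity = solve-∀
... | Bézout.-+ x y eq = - + x , + y ,
  trans (identity (+ gcd m n) (+ x) (+ m)) (cong (_+_ (- + x * + m)) (pos-+-* (gcd m n) x m y n eq))
  where
  identity : ∀ d x m → d ≡ - x * m + (d + x * m)
  identity = solve-∀

crt : ∀ {s t} .{{_ : NonZero s}} .{{_ : NonZero t}} {u w} → u ≡ w mod gcd s t →
      ∃ λ k → (+ k ≡ u mod s) × (+ k ≡ w mod t)
crt {s} {t} {u} {w} (m , u≡w+mg) with bézout s t
... | x , y , g≡xs+yt =
  k , mod-trans (mod-∣ (m∣m*n t) k≡k₀) k₀≡u , mod-trans (mod-∣ (n∣m*n s) k≡k₀) k₀≡w
  where
  instance
    st≢0 : NonZero (s ℕ.* t)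
    st≢0 = ℕ.m*n≢0 s t
  k₀ : ℤ
  k₀ = u - m * x * + s
  k : ℕ
  k = k₀ %ℕ (s ℕ.* t)
  k≡k₀ : + k ≡ k₀ mod s ℕ.* t
  k≡k₀ = mod-sym (mod-%ℕ k₀)
  k₀≡u : k₀ ≡ u mod s
  k₀≡u = - (m * x) , identity u m x (+ s)
    where
    identity : ∀ u m x s → u - m * x * s ≡ u + - (m * x) * s
    identity = solve-∀
  k₀≡w : k₀ ≡ w mod t
  k₀≡w = m * y , (begin
    u - m * x * + s                         ≡⟨ cong (λ v → v - m * x * + s) u≡w+mg ⟩
    w + m * + gcd s t - m * x * + s         ≡⟨ cong (λ g → w + m * g - m * x * + s) g≡xs+yt ⟩
    w + m * (x * + s + y * + t) - m * x * + s ≡⟨ identity w m x y (+ s) (+ t) ⟩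
    w + m * y * + t                         ∎)
    where
    open ≡-Reasoning
    identity : ∀ w m x y s t → w + m * (x * s + y * t) - m * x * s ≡ w + m * y * t
    identity = solve-∀

module _ {V : Set} {D : V → V → Set} where

  infixr 5 _++_ _++ˢ_

  _++_ : ∀ {u v w} → Walk D u v → Walk D v w → Walk D u w
  [] ++ q = q
  step e p ++ q = step e (p ++ q)

  reverse : ∀ {u v} → Walk D u v → Walk D v u
  reverse [] = []
  reverse (step (inj₁ d) p) = reverse p ++ step (inj₂ d) []
  reverse (step (inj₂ d) p) = reverse p ++ step (inj₁ d) []

  _++ˢ_ : ∀ {u v w i j} → SumWalk D u v i → SumWalk D v w j → SumWalk D u w (i + j)
  _++ˢ_ {j = j} [] q = subst (SumWalk D _ _) (sym (ℤ.+-identityˡ j)) q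
  _++ˢ_ {j = j} (pos {z = i} d p) q = subst (SumWalk D _ _) (sym (ℤ.+-assoc 1ℤ i j)) (pos d (p ++ˢ q))
  _++ˢ_ {j = j} (neg {z = i} d p) q = subst (SumWalk D _ _) (sym (ℤ.+-assoc -1ℤ i j)) (neg d (p ++ˢ q))

  alter-successors : ∀ {u u′ v v′} → AlterRelated D u u′ → D u v → D u′ v′ → AlterRelated D v v′
  alter-successors w d d′ = neg d (w ++ˢ pos d′ [])

  alter-predecessors : ∀ {u u′ v v′} → AlterRelated D v v′ → D u v → D u′ v′ → AlterRelated D u u′
  alter-predecessors w d d′ = pos d (w ++ˢ neg d′ [])

mapWalk : ∀ {V W : Set} {D : V → V → Set} {E : W → W → Set} (f : V → W) →
          (∀ {u v} → D u v → Walk E (f u) (f v)) → ∀ {u v} → Walk D u v → Walk E (f u) (f v)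
mapWalk f f-dart [] = []
mapWalk f f-dart (step (inj₁ d) p) = f-dart d ++ mapWalk f f-dart p
mapWalk f f-dart (step (inj₂ d) p) = reverse (f-dart d) ++ mapWalk f f-dart p

module Orbit {s : ℕ} (σ : Fin s → Fin s) (σ-injective : Injective _≡_ _≡_ σ) (k₀ : Fin s) where

  orbit : ℕ → Fin s
  orbit n = fold k₀ σ n

  Covers : Set
  Covers = ∀ k → ∃ λ n → orbit n ≡ k

  fold-cancel : ∀ {k k′} n → fold k σ n ≡ fold k′ σ n → k ≡ k′
  fold-cancel zero e = e
  fold-cancel (suc n) e = fold-cancel n (σ-injective e)

  period-of-repeat : ∀ {i j} → i < j → orbit i ≡ orbit j → ∃ λ d → i ℕ.+ suc d ≡ j × orbit (suc d) ≡ k₀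
  period-of-repeat {i} i<j e with d , refl ← ℕ.m≤n⇒∃[o]m+o≡n i<j =
    d , ℕ.+-suc i d , sym (fold-cancel i (trans e (trans (cong orbit (sym (ℕ.+-suc i d))) (fold-+ k₀ σ i))))

  bounded-period : ∃ λ d → suc d ≤ s × orbit (suc d) ≡ k₀
  bounded-period with i , j , i<j , e ← Fin.pigeonhole (ℕ.n<1+n s) (λ i → orbit (toℕ i))
                 with d , i+d′≡j , period ← period-of-repeat i<j e =
    d , ℕ.≤-trans (ℕ.m≤n+m (suc d) (toℕ i)) (ℕ.≤-trans (ℕ.≤-reflexive i+d′≡j) (ℕ.≤-pred (Fin.toℕ<n j))) ,
    period

  module Periodic (q : ℕ) .{{_ : NonZero q}} (period : orbit q ≡ k₀) where

    orbit-multiple : ∀ j → orbit (j ℕ.* q) ≡ k₀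
    orbit-multiple zero = refl
    orbit-multiple (suc j) = trans (fold-+ k₀ σ q) (trans (cong (λ k → fold k σ q) (orbit-multiple j)) period)

    orbit-% : ∀ n → orbit (n % q) ≡ orbit n
    orbit-% n = begin
      orbit (n % q)                         ≡⟨ cong (λ k → fold k σ (n % q)) (orbit-multiple (n / q)) ⟨
      fold (orbit (n / q ℕ.* q)) σ (n % q)  ≡⟨ fold-+ k₀ σ (n % q) ⟨
      orbit (n % q ℕ.+ n / q ℕ.* q)         ≡⟨ cong orbit (m≡m%n+[m/n]*n n q) ⟨
      orbit n                               ∎
      where open ≡-Reasoning

    orbit-predecessor : ∀ {k n} → σ k ≡ orbit n → orbit (n ℕ.+ pred q) ≡ k
    orbit-predecessor {k} {n} e = σ-injective (begin
      σ (orbit (n ℕ.+ pred q))    ≡⟨⟩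
      orbit (suc (n ℕ.+ pred q))  ≡⟨ cong orbit (ℕ.+-suc n (pred q)) ⟨
      orbit (n ℕ.+ suc (pred q))  ≡⟨ cong (λ m → orbit (n ℕ.+ m)) (ℕ.suc-pred q) ⟩
      orbit (n ℕ.+ q)             ≡⟨ fold-+ k₀ σ n ⟩
      fold (orbit q) σ n          ≡⟨ cong (λ k → fold k σ n) period ⟩
      orbit n                     ≡⟨ e ⟨
      σ k                         ∎)
      where open ≡-Reasoning

    ≤-period : Covers → s ≤ q
    ≤-period covers = Fin.injective⇒≤ {f = position} position-injective
      where
      position : Fin s → Fin q
      position k = fromℕ< (m%n<n (proj₁ (covers k)) q)
      orbit-position : ∀ k → orbit (toℕ (position k)) ≡ k
      orbit-position k = trans (cong orbit (Fin.toℕ-fromℕ< (m%n<n (proj₁ (covers k)) q)))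
                               (trans (orbit-% (proj₁ (covers k))) (proj₂ (covers k)))
      position-injective : Injective _≡_ _≡_ position
      position-injective {k} {k′} e =
        trans (sym (orbit-position k)) (trans (cong (orbit ∘′ toℕ) e) (orbit-position k′))

  module Transitive (covers : Covers) where

    instance
      s≢0 : NonZero s
      s≢0 = Fin.nonZeroIndex k₀

    orbit-period : orbit s ≡ k₀
    orbit-period with d , d<s , period ← bounded-period =
      subst (λ q → orbit q ≡ k₀) (ℕ.≤-antisym d<s (Periodic.≤-period (suc d) period covers)) period

    open Periodic s orbit-period using (orbit-%)

    repeat-≥ : ∀ {i j} → i < j → orbit i ≡ orbit j → s ≤ j
    repeat-≥ {i} i<j e with d , i+d′≡j , period ← period-of-repeat i<j e =
      ℕ.≤-trans (Periodic.≤-period (suc d) period covers)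
                (ℕ.≤-trans (ℕ.m≤n+m (suc d) i) (ℕ.≤-reflexive i+d′≡j))

    orbit-injective-below : ∀ {i j} → i < s → j < s → orbit i ≡ orbit j → i ≡ j
    orbit-injective-below {i} {j} i<s j<s e with ℕ.<-cmp i j
    ... | tri< i<j _ _ = ⊥-elim (ℕ.<⇒≱ j<s (repeat-≥ i<j e))
    ... | tri≈ _ i≡j _ = i≡j
    ... | tri> _ _ j<i = ⊥-elim (ℕ.<⇒≱ i<s (repeat-≥ j<i (sym e)))

    orbit-≡⇔% : ∀ {m n} → (orbit m ≡ orbit n) ⇔ (m % s ≡ n % s)
    orbit-≡⇔% {m} {n} = mk⇔
      (λ e → orbit-injective-below (m%n<n m s) (m%n<n n s) (trans (orbit-% m) (trans e (sym (orbit-% n)))))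
      (λ e → trans (sym (orbit-% m)) (trans (cong orbit e) (orbit-% n)))

record Levelling {V : Set} (D : V → V → Set) (s : ℕ) : Set where
  field
    level : V → ℤ
    level-dart : ∀ {u v} → D u v → level v ≡ 1ℤ + level u mod s
    level-alter : ∀ {u v} → level u ≡ level v mod s → AlterRelated D u v

module _ {V : Set} {D : V → V → Set} {s : ℕ} (v₀ : V) (connected : IsConnected D) (no-sinks : NoSinks D)
         (classes : HasExactlyClasses (AlterRelated D) s) where

  private
    c : V → Fin s
    c = proj₁ classes

    rep : Fin s → V
    rep k = proj₁ (proj₁ (proj₂ classes) k)

    c-rep : ∀ k → c (rep k) ≡ k
    c-rep k = proj₂ (proj₁ (proj₂ classes) k) refl

    ≡c⇒alter : ∀ {u v} → c u ≡ c v → AlterRelated D u v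
    ≡c⇒alter {u} {v} = Equivalence.to (proj₂ (proj₂ classes) u v)

    alter⇒≡c : ∀ {u v} → AlterRelated D u v → c u ≡ c v
    alter⇒≡c {u} {v} = Equivalence.from (proj₂ (proj₂ classes) u v)

    next : V → V
    next v = proj₁ (no-sinks v)

    next-dart : ∀ v → D v (next v)
    next-dart v = proj₂ (no-sinks v)

    σ : Fin s → Fin s
    σ k = c (next (rep k))

    σ-dart : ∀ {u v} → D u v → σ (c u) ≡ c v
    σ-dart {u} d = alter⇒≡c (alter-successors (≡c⇒alter (c-rep (c u))) (next-dart _) d)

    σ-injective : ∀ {k k′} → σ k ≡ σ k′ → k ≡ k′
    σ-injective {k} {k′} e = begin
      k              ≡⟨ c-rep k ⟨
      c (rep k)      ≡⟨ alter⇒≡c (alter-predecessors (≡c⇒alter e) (next-dart _) (next-dart _)) ⟩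
      c (rep k′)     ≡⟨ c-rep k′ ⟩
      k′             ∎
      where open ≡-Reasoning

    open Orbit σ σ-injective (c v₀)

    covers : Covers
    covers k with q , _ , period ← bounded-period =
      let n , e = reach (connected v₀ (rep k)) (0 , refl) in n , trans e (c-rep k)
      where
      open Periodic (suc q) period using (orbit-predecessor)
      reach : ∀ {u v} → Walk D u v → ∃ (λ n → orbit n ≡ c u) → ∃ λ n → orbit n ≡ c v
      reach [] found = found
      reach (step (inj₁ d) p) (n , e) = reach p (suc n , trans (cong σ e) (σ-dart d))
      reach (step (inj₂ d) p) (n , e) = reach p (n ℕ.+ q , orbit-predecessor {n = n} (trans (σ-dart d) (sym e)))

    open Transitive covers

    index : V → ℕ
    index v = proj₁ (covers (c v))

    orbit-index : ∀ v → orbit (index v) ≡ c v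
    orbit-index v = proj₂ (covers (c v))

  classes⇒levelling : Levelling D s
  classes⇒levelling = record
    { level = λ v → + index v
    ; level-dart = λ {u} {v} d → mod-sym (Equivalence.to %ℕ-≡⇔mod (Equivalence.to orbit-≡⇔%
        (trans (cong σ (orbit-index u)) (trans (σ-dart d) (sym (orbit-index v))))))
    ; level-alter = λ {u} {v} e → ≡c⇒alter
        (trans (sym (orbit-index u))
          (trans (Equivalence.from orbit-≡⇔% (Equivalence.from %ℕ-≡⇔mod e)) (orbit-index v)))
    }

forward : ∀ {V : Set} {D : V → V → Set} → NoSinks D → ℕ → V → V
forward no-sinks k a = iterate (λ v → proj₁ (no-sinks v)) a k

forward-walk : ∀ {V W : Set} {D : V → V → Set} {E : W → W → Set}
               (no-sinks-D : NoSinks D) (no-sinks-E : NoSinks E) → ∀ k a x → Walk (Pointwise D E) (a , x) (forward no-sinks-D k a , forward no-sinks-E k x)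
forward-walk no-sinks-D no-sinks-E zero a x = []
forward-walk no-sinks-D no-sinks-E (suc k) a x =
  step (inj₁ (proj₂ (no-sinks-D a) , proj₂ (no-sinks-E x))) (forward-walk no-sinks-D no-sinks-E k _ _)

module _ {V : Set} {D : V → V → Set} {s : ℕ} (L : Levelling D s) (no-sinks : NoSinks D) where
  open Levelling L

  level-forward : ∀ k a → level (forward no-sinks k a) ≡ level a + + k mod s
  level-forward zero a = mod-reflexive (sym (ℤ.+-identityʳ (level a)))
  level-forward (suc k) a = begin
    level (forward no-sinks k a′)  ≈⟨ level-forward k a′ ⟩
    level a′ + + k                 ≈⟨ mod-+-congʳ (+ k) (level-dart (proj₂ (no-sinks a))) ⟩
    1ℤ + level a + + k             ≡⟨ identity 1ℤ (level a) (+ k) ⟩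
    level a + + suc k              ∎
    where
    identity : ∀ o l k → o + l + k ≡ l + (o + k)
    identity = solve-∀
    a′ : V
    a′ = proj₁ (no-sinks a)
    open Relation.Binary.Reasoning.Setoid mod-setoid

  forward-alter : ∀ {k a b} → + k ≡ level b - level a mod s → AlterRelated D (forward no-sinks k a) b
  forward-alter {k} {a} {b} k≡b-a = level-alter (begin
    level (forward no-sinks k a)   ≈⟨ level-forward k a ⟩
    level a + + k                  ≈⟨ mod-+-congˡ (level a) k≡b-a ⟩
    level a + (level b - level a)  ≡⟨ identity (level a) (level b) ⟩
    level b                        ∎)
    where
    open Relation.Binary.Reasoning.Setoid mod-setoid
    identity : ∀ a b → a + (b - a) ≡ b
    identity = solve-∀

data Path {W : Set} (E : W → W → Set) : W → W → ℕ → Set where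
  [] : ∀ {x} → Path E x x 0
  _∷_ : ∀ {x y z n} → E x y → Path E y z n → Path E x z (suc n)

module Lifting {V W : Set} (D : V → V → Set) {E : W → W → Set}
               (no-sources : NoSources E) (no-sinks : NoSinks E) where

  MonotonePath : W → W → ℤ → Set
  MonotonePath x y (+ n) = Path E x y n
  MonotonePath x y -[1+ n ] = Path (flip E) x y (suc n)

  forward-step : ∀ {x y} z → MonotonePath x y (1ℤ + z) → ∃ λ x′ → E x x′ × MonotonePath x′ y z
  forward-step (+ n) (e ∷ p) = _ , e , p
  forward-step {x} -[1+ zero ] [] = let x′ , e = no-sinks x in x′ , e , e ∷ []
  forward-step {x} -[1+ suc n ] p = let x′ , e = no-sinks x in x′ , e , e ∷ p

  backward-step : ∀ {x y} z → MonotonePath x y (-1ℤ + z) → ∃ λ x′ → E x′ x × MonotonePath x′ y z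
  backward-step (+ zero) (e ∷ []) = _ , e , []
  backward-step {x} (+ suc n) p = let x′ , e = no-sources x in x′ , e , e ∷ p
  backward-step -[1+ n ] (e ∷ p) = _ , e , p

  -- The second coordinate keeps a monotone path whose signed length is the running sum
  -- of the walk, so it is back where it started once that sum returns to 0.
  lift : ∀ {a a′ x y z} → SumWalk D a a′ z → MonotonePath x y z → Walk (Pointwise D E) (a , x) (a′ , y)
  lift [] [] = []
  lift (pos {z = z} d w) p with forward-step z p
  ... | _ , e , p′ = step (inj₁ (d , e)) (lift w p′)
  lift (neg {z = z} d w) p with backward-step z p
  ... | _ , e , p′ = step (inj₂ (d , e)) (lift w p′)

  lift-alter : ∀ {a a′} → AlterRelated D a a′ → ∀ x → Walk (Pointwise D E) (a , x) (a′ , x)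
  lift-alter w x = lift w []

module SBP (Γ₁ Γ₂ : Digraph) {s t : ℕ} .{{_ : NonZero s}} .{{_ : NonZero t}}
           (L₁ : Levelling (Dart Γ₁) s) (L₂ : Levelling (Dart Γ₂) t)
           (no-sources₁ : NoSources (Dart Γ₁)) (no-sinks₁ : NoSinks (Dart Γ₁))
           (no-sources₂ : NoSources (Dart Γ₂)) (no-sinks₂ : NoSinks (Dart Γ₂)) where

  open Levelling L₁ using () renaming (level to ℓ₁; level-dart to ℓ₁-dart)
  open Levelling L₂ using () renaming (level to ℓ₂; level-dart to ℓ₂-dart)

  g : ℕ
  g = gcd s t

  instance
    g≢0 : NonZero g
    g≢0 = ℕ.≢-nonZero (gcd[m,n]≢0 s t (inj₁ (ℕ.≢-nonZero⁻¹ s)))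

  open Relation.Binary.Reasoning.Setoid (mod-setoid {g})

  potential : Vtx Γ₁ × Vtx Γ₂ × Fin 2 → ℤ
  potential (a , x , zero) = 1ℤ + ℓ₁ a - ℓ₂ x
  potential (a , x , suc zero) = ℓ₁ a - ℓ₂ x

  potential-dart : ∀ {u v} → SBPDart Γ₁ Γ₂ u v → potential u ≡ potential v mod g
  potential-dart (first {x = x} d) = mod-∣ (gcd[m,n]∣m s t) (mod-+-congʳ (- ℓ₂ x) (mod-sym (ℓ₁-dart d)))
  potential-dart (second {a} {x} {y} d) = begin
    ℓ₁ a - ℓ₂ x               ≡⟨ identity (ℓ₁ a) (ℓ₂ x) ⟩
    1ℤ + ℓ₁ a - (1ℤ + ℓ₂ x)
      ≈⟨ mod-∣ (gcd[m,n]∣n s t) (mod-+-congˡ (1ℤ + ℓ₁ a) (mod-neg (mod-sym (ℓ₂-dart d)))) ⟩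
    1ℤ + ℓ₁ a - ℓ₂ y          ∎
    where
    identity : ∀ a x → a - x ≡ 1ℤ + a - (1ℤ + x)
    identity = solve-∀

  potential-walk : ∀ {u v} → Connected (SBPDart Γ₁ Γ₂) u v → potential u ≡ potential v mod g
  potential-walk [] = mod-refl
  potential-walk (step (inj₁ d) p) = mod-trans (potential-dart d) (potential-walk p)
  potential-walk (step (inj₂ d) p) = mod-trans (mod-sym (potential-dart d)) (potential-walk p)

  private
    D₁ : Vtx Γ₁ → Vtx Γ₁ → Set
    D₁ = Dart Γ₁
    D₂ : Vtx Γ₂ → Vtx Γ₂ → Set
    D₂ = Dart Γ₂
    SBPWalk : (u v : Vtx Γ₁ × Vtx Γ₂ × Fin 2) → Set
    SBPWalk = Walk (SBPDart Γ₁ Γ₂)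

  walk₁₂ : ∀ {a x b y} → Walk (Pointwise D₁ D₂) (a , x) (b , y) → SBPWalk (a , x , zero) (b , y , zero)
  walk₁₂ = mapWalk (λ (a , x) → a , x , zero) λ (d , e) → step (inj₁ (first d)) (step (inj₁ (second e)) [])

  walk₂₁ : ∀ {a x b y} → Walk (Pointwise D₂ D₁) (x , a) (y , b) → SBPWalk (a , x , zero) (b , y , zero)
  walk₂₁ = mapWalk (λ (x , a) → a , x , zero) λ (e , d) → step (inj₁ (first d)) (step (inj₁ (second e)) [])

  differences-congruent : ∀ {a x a′ x′} → potential (a , x , zero) ≡ potential (a′ , x′ , zero) mod g →
                          ℓ₁ a′ - ℓ₁ a ≡ ℓ₂ x′ - ℓ₂ x mod g
  differences-congruent {a} {x} {a′} {x′} e = begin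
    ℓ₁ a′ - ℓ₁ a               ≡⟨ identity (ℓ₁ a) (ℓ₁ a′) (ℓ₂ x) (ℓ₂ x′) ⟩
    ℓ₂ x′ - ℓ₂ x + (P′ - P)    ≈⟨ mod-+-congˡ (ℓ₂ x′ - ℓ₂ x) (mod-+-congˡ P′ (mod-neg e)) ⟩
    ℓ₂ x′ - ℓ₂ x + (P′ - P′)   ≡⟨ identity′ (ℓ₂ x′ - ℓ₂ x) P′ ⟩
    ℓ₂ x′ - ℓ₂ x               ∎
    where
    P P′ : ℤ
    P = potential (a , x , zero)
    P′ = potential (a′ , x′ , zero)
    identity : ∀ a a′ x x′ → a′ - a ≡ x′ - x + ((1ℤ + a′ - x′) - (1ℤ + a - x))
    identity = solve-∀
    identity′ : ∀ i j → i + (j - j) ≡ i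
    identity′ = solve-∀

  layer₀-connected : ∀ {a x a′ x′} → potential (a , x , zero) ≡ potential (a′ , x′ , zero) mod g →
                     SBPWalk (a , x , zero) (a′ , x′ , zero)
  layer₀-connected {a} {x} e =
    let k , k≡Δa , k≡Δx = crt (differences-congruent e) in
    walk₁₂ (forward-walk no-sinks₁ no-sinks₂ k a x)
    ++ walk₁₂ (Lifting.lift-alter D₁ no-sources₂ no-sinks₂ (forward-alter L₁ no-sinks₁ k≡Δa) _)
    ++ walk₂₁ (Lifting.lift-alter D₂ no-sources₁ no-sinks₁ (forward-alter L₂ no-sinks₂ k≡Δx) _)

  to-layer₀ : ∀ v → ∃ λ ((a , x) : Vtx Γ₁ × Vtx Γ₂) → SBPWalk v (a , x , zero)
  to-layer₀ (a , x , zero) = (a , x) , []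
  to-layer₀ (a , x , suc zero) = (a , proj₁ (no-sinks₂ x)) , step (inj₁ (second (proj₂ (no-sinks₂ x)))) []

  connected⇔potential : ∀ u v → Connected (SBPDart Γ₁ Γ₂) u v ⇔ (potential u ≡ potential v mod g)
  connected⇔potential u v = mk⇔ potential-walk λ e →
    let _ , u⇝ = to-layer₀ u; _ , v⇝ = to-layer₀ v in
    u⇝ ++ layer₀-connected (mod-trans (mod-sym (potential-walk u⇝)) (mod-trans e (potential-walk v⇝)))
       ++ reverse v⇝

  potential-hits-every-residue : ∀ (r : Fin g) → ∃ λ v → potential v ≡ + toℕ r mod g
  potential-hits-every-residue r = (forward no-sinks₁ k zero , zero , zero) , (begin
    1ℤ + ℓ₁ (forward no-sinks₁ k zero) - ℓ₂ zero
      ≈⟨ mod-+-congʳ (- ℓ₂ zero)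
           (mod-+-congˡ 1ℤ (mod-∣ (gcd[m,n]∣m s t) (level-forward L₁ no-sinks₁ k zero))) ⟩
    1ℤ + (ℓ₁ zero + + k) - ℓ₂ zero     ≡⟨ identity 1ℤ (ℓ₁ zero) (ℓ₂ zero) (+ k) ⟩
    P₀ + + k                           ≈⟨ mod-+-congˡ P₀ (mod-sym (mod-%ℕ (+ toℕ r - P₀))) ⟩
    P₀ + (+ toℕ r - P₀)                ≡⟨ identity′ P₀ (+ toℕ r) ⟩
    + toℕ r                            ∎)
    where
    P₀ : ℤ
    P₀ = potential (zero , zero , zero)
    k : ℕ
    k = (+ toℕ r - P₀) %ℕ g
    identity : ∀ o a x k → o + (a + k) - x ≡ o + a - x + k
    identity = solve-∀
    identity′ : ∀ p r → p + (r - p) ≡ r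
    identity′ = solve-∀

classes-from-invariant : ∀ {V : Set} {R : V → V → Set} {n} .{{_ : NonZero n}} (f : V → ℤ) →
  (∀ u v → R u v ⇔ (f u ≡ f v mod n)) → (∀ r → ∃ λ v → f v ≡ + toℕ r mod n) →
  HasExactlyClasses R n
classes-from-invariant f R⇔≡f hits =
  residue ∘ f ,
  (λ r → let v , fv≡r = hits r in
    v , λ { refl → trans (Equivalence.from residue-≡⇔mod fv≡r) (residue-toℕ r) }) ,
  λ u v → ⇔.trans residue-≡⇔mod (⇔.sym (R⇔≡f u v))

theorem3p6 : (Γ₁ Γ₂ : Digraph) (s t : ℕ) →
    IsOrientation (Dart Γ₁) → IsConnected (Dart Γ₁) →
    NoSources (Dart Γ₁) → NoSinks (Dart Γ₁) →
    IsOrientation (Dart Γ₂) → IsConnected (Dart Γ₂) →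
    NoSources (Dart Γ₂) → NoSinks (Dart Γ₂) →
    AlterPerimeter Γ₁ s → AlterPerimeter Γ₂ t →
    NumComponents (SBPDart Γ₁ Γ₂) (gcd s t)
theorem3p6 Γ₁ Γ₂ s t _ connected₁ no-sources₁ no-sinks₁
                      _ connected₂ no-sources₂ no-sinks₂ classes₁ classes₂ =
  classes-from-invariant potential connected⇔potential potential-hits-every-residue
  where
  instance
    s≢0 : NonZero s
    s≢0 = Fin.nonZeroIndex (proj₁ classes₁ zero)
    t≢0 : NonZero t
    t≢0 = Fin.nonZeroIndex (proj₁ classes₂ zero)
  open SBP Γ₁ Γ₂ (classes⇒levelling zero connected₁ no-sinks₁ classes₁)
           (classes⇒levelling zero connected₂ no-sinks₂ classes₂)
           no-sources₁ no-sinks₁ no-sources₂ no-sinks₂
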